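{- Let $1=a_0<a_1<\cdots<a_N$ be an addition chain in which, for each step $u\ge 1$, a representation $a_u=a_{t(u)}+a_{r(u)}$ with $0\le r(u)\le t(u)<u$ is specified. Suppose $j\ge 1$ and $L\ge 1$ are such that $j+L+1\le N$, $a_j=2a_{j-1}$, $a_{j+L+1}=2a_{j+L}$, and none of the steps $j+1,\dots,j+L$ is a doubling step (so $a_{j+1},\dots,a_{j+L}$ is an addition block). Assume that for every $s$ with $j+1\le s\le j+L$, each of the indices $t(s),r(s)$ that is smaller than $j+1$ is a doubling step (i.e. it is an index $i\ge1$ with $a_i=2a_{i-1}$). Then the block $a_{j+1},\dots,a_{j+L}$ is marked: if the chain is valid, then there exist $s\in\{j,\dots,j+L-1\}$ and a step $u>j+L$ such that $s\in\{t(u),r(u)\}$.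
   Context: An addition chain of length $N$ is a sequence of integers $1=a_0<a_1<\cdots<a_N$ such that for each $1\le j\le N$ there are indices $0\le i,s<j$ with $a_j=a_s+a_i$; step $j$ is a doubling step if $a_j=2a_{j-1}$. Given two addition chains $1=a_0<\cdots<a_N=n$ and $1=b_0<\cdots<b_N=n$ of the same length leading to the same integer, the chain $(a_j)$ dominates $(b_j)$ if $b_j\le a_j$ for all $j$ and $b_s<a_s$ for some $s$. A chain is valid if it dominates no other addition chain of the same length leading to the same integer. -}

module Defs where

open import Data.Nat using (ℕ; zero; suc; _+_; _*_; _∸_; _≤_; _<_)
open import Data.Product using (Σ; ∃; _×_)
open import Relation.Nullary using (¬_)
open import Relation.Binary.PropositionalEquality using (_≡_)

-- A sequence is modelled as a function a : ℕ → ℕ; only the entries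
-- a 0, …, a N are relevant (values beyond N are ignored everywhere).

record IsAdditionChain (N : ℕ) (a : ℕ → ℕ) (n : ℕ) : Set where
  field
    start      : a 0 ≡ 1
    increasing : ∀ i → i < N → a i < a (suc i)
    sums       : ∀ j → 1 ≤ j → j ≤ N →
                   ∃ λ i → ∃ λ s → i < j × s < j × a j ≡ a s + a i
    end        : a N ≡ n

Doubling : (ℕ → ℕ) → ℕ → Set
Doubling a i = 1 ≤ i × a i ≡ 2 * a (i ∸ 1)

Dominates : ℕ → (ℕ → ℕ) → (ℕ → ℕ) → Set
Dominates N a b = (∀ j → j ≤ N → b j ≤ a j) × (∃ λ s → s ≤ N × b s < a s)

Valid : ℕ → (ℕ → ℕ) → Set
Valid N a = ¬ (∃ λ b → IsAdditionChain N b (a N) × Dominates N a b)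

IsRepresentation : ℕ → (ℕ → ℕ) → (ℕ → ℕ) → (ℕ → ℕ) → Set
IsRepresentation N a t r =
  ∀ u → 1 ≤ u → u ≤ N → r u ≤ t u × t u < u × a u ≡ a (t u) + a (r u)

{-# OPTIONS --safe #-}
-- Suppose no step after j + L reads one of the indices j, …, j + L - 1.
-- Move the addition block one place down and halve it: b i = a (i + 1) / 2
-- for j ≤ i < j + L and b i = a i otherwise.  Every summand index x ≤ j of
-- a block step is a doubling step, so by induction all block entries are
-- even and a x = 2 b (x - 1) for every summand index x of the block; hence b
-- is again an addition chain, in which step j + L has become a doubling.
-- A non-doubling step has a (i + 1) < 2 a i, so b i < a i on the window and
-- a dominates b, contradicting validity.
module Submission where

open import Defs
open import Data.Nat using (ℕ; zero; suc; _+_; _*_; _∸_; _≤_; _<_; _/_; s≤s; z≤n; _≤?_; _<?_)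
open import Data.Nat.Properties
open import Data.Nat.Divisibility using (_∣_; m∣m*n; ∣m∣n⇒∣m+n)
open import Data.Nat.DivMod using (m*[n/m]≡n)
open import Data.Nat.Induction using (<-rec)
open import Data.Product using (∃; _×_; _,_; proj₁; proj₂)
open import Data.Sum using (_⊎_; inj₁; inj₂)
open import Function using (_∘_)
open import Relation.Binary using (tri<; tri≈; tri>)
open import Relation.Binary.PropositionalEquality using (_≡_; refl; sym; trans; cong; cong₂; subst; subst₂; module ≡-Reasoning)
open import Relation.Nullary using (¬_; Dec; yes; no)
open import Relation.Nullary.Decidable using (_×-dec_; _⊎-dec_)
open import Relation.Nullary.Negation using (contradiction)
open import Relation.Unary using (Decidable)

module _ {N n : ℕ} {a : ℕ → ℕ} (C : IsAdditionChain N a n) where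
  open IsAdditionChain C

  chain-mono : ∀ {k m} → k ≤ m → m ≤ N → a k ≤ a m
  chain-mono {m = zero} z≤n _ = ≤-refl
  chain-mono {k} {suc m} k≤1+m 1+m≤N with m≤n⇒m<n∨m≡n k≤1+m
  ... | inj₂ refl = ≤-refl
  ... | inj₁ k<1+m = ≤-trans (chain-mono (≤-pred k<1+m) (≤-trans (n≤1+n m) 1+m≤N))
                             (<⇒≤ (increasing m 1+m≤N))

  chain-step≤double : ∀ {i} → suc i ≤ N → a (suc i) ≤ 2 * a i
  chain-step≤double {i} 1+i≤N with sums (suc i) (s≤s z≤n) 1+i≤N
  ... | i′ , s , i′<1+i , s<1+i , a-sum = begin
    a (suc i)    ≡⟨ a-sum ⟩
    a s + a i′   ≤⟨ +-mono-≤ (chain-mono (≤-pred s<1+i) i≤N) (chain-mono (≤-pred i′<1+i) i≤N) ⟩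
    a i + a i    ≡⟨ cong (a i +_) (sym (+-identityʳ (a i))) ⟩
    2 * a i      ∎
    where
    open ≤-Reasoning
    i≤N = ≤-trans (n≤1+n i) 1+i≤N

  chain-nondoubling< : ∀ {i} → suc i ≤ N → ¬ Doubling a (suc i) → a (suc i) < 2 * a i
  chain-nondoubling< 1+i≤N not-doubling =
    ≤∧≢⇒< (chain-step≤double 1+i≤N) (not-doubling ∘ (s≤s z≤n ,_))

Window : ℕ → ℕ → ℕ → Set
Window j L i = j ≤ i × i < j + L

window? : ∀ j L → Decidable (Window j L)
window? j L i = (j ≤? i) ×-dec (i <? j + L)

ReadsWindow : (t r : ℕ → ℕ) (j L u : ℕ) → Set
ReadsWindow t r j L u = j + L < u × (Window j L (t u) ⊎ Window j L (r u))

readsWindow? : ∀ t r j L → Decidable (ReadsWindow t r j L)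
readsWindow? t r j L u = (j + L <? u) ×-dec (window? j L (t u) ⊎-dec window? j L (r u))

lowerBlock : (ℕ → ℕ) → ℕ → ℕ → ℕ → ℕ
lowerBlock a j L i with window? j L i
... | yes _ = a (suc i) / 2
... | no _  = a i

module LowerBlock {a : ℕ → ℕ} {j L : ℕ} where

  lowerBlock-inside : ∀ {i} → Window j L i → lowerBlock a j L i ≡ a (suc i) / 2
  lowerBlock-inside {i} w with window? j L i
  ... | yes _ = refl
  ... | no ¬w = contradiction w ¬w

  lowerBlock-outside : ∀ {i} → ¬ Window j L i → lowerBlock a j L i ≡ a i
  lowerBlock-outside {i} ¬w with window? j L i
  ... | yes w = contradiction w ¬w
  ... | no _  = refl

  lowerBlock-below : ∀ {i} → i < j → lowerBlock a j L i ≡ a i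
  lowerBlock-below i<j = lowerBlock-outside (<⇒≱ i<j ∘ proj₁)

  lowerBlock-above : ∀ {i} → j + L ≤ i → lowerBlock a j L i ≡ a i
  lowerBlock-above j+L≤i = lowerBlock-outside λ (_ , i<j+L) → <⇒≱ i<j+L j+L≤i

module Lowering
  {N n : ℕ} {a t r : ℕ → ℕ} (C : IsAdditionChain N a n) (R : IsRepresentation N a t r)
  {j L : ℕ} (1≤j : 1 ≤ j) (j+L≤N : j + L ≤ N)
  (doubling-j : Doubling a j)
  (block-nondoubling : ∀ s → j + 1 ≤ s → s ≤ j + L → ¬ Doubling a s)
  (block-summands : ∀ s → j + 1 ≤ s → s ≤ j + L →
     (t s < j + 1 → Doubling a (t s)) × (r s < j + 1 → Doubling a (r s)))
  where

  open IsAdditionChain C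
  open LowerBlock {a} {j} {L}

  b : ℕ → ℕ
  b = lowerBlock a j L

  Admissible : ℕ → Set
  Admissible x = x ≤ j → Doubling a x

  j<⇒j+1≤ : ∀ {s} → j < s → j + 1 ≤ s
  j<⇒j+1≤ {s} = subst (_≤ s) (+-comm 1 j)

  summands-admissible : ∀ {s} → j < s → s ≤ j + L → Admissible (t s) × Admissible (r s)
  summands-admissible {s} j<s s≤j+L with block-summands s (j<⇒j+1≤ j<s) s≤j+L
  ... | doubling-t , doubling-r = doubling-t ∘ ≤⇒<j+1 , doubling-r ∘ ≤⇒<j+1
    where
    ≤⇒<j+1 : ∀ {x} → x ≤ j → x < j + 1
    ≤⇒<j+1 {x} x≤j = subst (x <_) (+-comm 1 j) (s≤s x≤j)

  admissible-positive : ∀ {x} → Admissible x → 1 ≤ x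
  admissible-positive {x} adm with x ≤? j
  ... | yes x≤j = proj₁ (adm x≤j)
  ... | no x≰j  = ≤-trans 1≤j (<⇒≤ (≰⇒> x≰j))

  admissible-even : ∀ x → x ≤ j + L → Admissible x → 2 ∣ a x
  admissible-even = <-rec (λ x → x ≤ j + L → Admissible x → 2 ∣ a x) even
    where
    even : ∀ x → (∀ {y} → y < x → y ≤ j + L → Admissible y → 2 ∣ a y) →
           x ≤ j + L → Admissible x → 2 ∣ a x
    even x rec x≤j+L adm with x ≤? j
    ... | yes x≤j = subst (2 ∣_) (sym (proj₂ (adm x≤j))) (m∣m*n (a (x ∸ 1)))
    ... | no x≰j
      with R x (≤-trans 1≤j (<⇒≤ (≰⇒> x≰j))) (≤-trans x≤j+L j+L≤N)
         | summands-admissible (≰⇒> x≰j) x≤j+L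
    ... | r≤t , t<x , a-sum | adm-t , adm-r =
      subst (2 ∣_) (sym a-sum)
        (∣m∣n⇒∣m+n (rec t<x (≤-trans (<⇒≤ t<x) x≤j+L) adm-t)
                   (rec r<x (≤-trans (<⇒≤ r<x) x≤j+L) adm-r))
      where r<x = ≤-<-trans r≤t t<x

  admissible-halved : ∀ {i} → i < j + L → Admissible (suc i) → a (suc i) ≡ 2 * b i
  admissible-halved {i} i<j+L adm with suc i ≤? j
  ... | yes i<j = trans (proj₂ (adm i<j)) (cong (2 *_) (sym (lowerBlock-below i<j)))
  ... | no i≮j  = trans (sym (m*[n/m]≡n (admissible-even (suc i) i<j+L adm)))
                        (cong (2 *_) (sym (lowerBlock-inside (≮⇒≥ i≮j , i<j+L))))

  lowered-double : ∀ {i} → j ≤ suc i → i < j + L → a (suc i) ≡ 2 * b i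
  lowered-double j≤1+i i<j+L = admissible-halved i<j+L
    λ 1+i≤j → subst (Doubling a) (≤-antisym j≤1+i 1+i≤j) doubling-j

  lowered-<-window : ∀ {i} → Window j L i → b i < a i
  lowered-<-window {i} (j≤i , i<j+L) = *-cancelˡ-< 2 (b i) (a i) (begin-strict
    2 * b i    ≡⟨ sym (lowered-double (m≤n⇒m≤1+n j≤i) i<j+L) ⟩
    a (suc i)  <⟨ chain-nondoubling< C (≤-trans i<j+L j+L≤N) not-doubling ⟩
    2 * a i    ∎)
    where
    open ≤-Reasoning
    not-doubling = block-nondoubling (suc i) (j<⇒j+1≤ (s≤s j≤i)) i<j+L

  lowered-≤ : ∀ i → b i ≤ a i
  lowered-≤ i = by-cases (window? j L i)
    where
    by-cases : Dec (Window j L i) → b i ≤ a i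
    by-cases (yes w) = <⇒≤ (lowered-<-window w)
    by-cases (no ¬w) = ≤-reflexive (lowerBlock-outside ¬w)

  lowered-increasing : ∀ i → i < N → b i < b (suc i)
  lowered-increasing i i<N = by-cases (window? j L (suc i))
    where
    open ≤-Reasoning
    by-cases : Dec (Window j L (suc i)) → b i < b (suc i)
    by-cases (yes (j≤1+i , 1+i<j+L)) = *-cancelˡ-< 2 (b i) (b (suc i))
      (subst₂ _<_ (lowered-double j≤1+i (<-trans (n<1+n i) 1+i<j+L))
                  (lowered-double (m≤n⇒m≤1+n j≤1+i) 1+i<j+L)
                  (increasing (suc i) (≤-trans 1+i<j+L j+L≤N)))
    by-cases (no 1+i∉) = begin-strict
      b i        ≤⟨ lowered-≤ i ⟩
      a i        <⟨ increasing i i<N ⟩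
      a (suc i)  ≡⟨ sym (lowerBlock-outside 1+i∉) ⟩
      b (suc i)  ∎

  halved-summand : ∀ {x m} → x < suc m → m < j + L → Admissible x → ∃ λ y → y < m × a x ≡ 2 * b y
  halved-summand {zero} _ _ adm = contradiction (admissible-positive adm) λ ()
  halved-summand {suc y} (s≤s y<m) m<j+L adm = y , y<m , admissible-halved (<-trans y<m m<j+L) adm

  SumOfEarlier : (ℕ → ℕ) → ℕ → Set
  SumOfEarlier c k = ∃ λ i → ∃ λ s → i < k × s < k × c k ≡ c s + c i

  lowered-sum-window : ∀ {m} → Window j L m → SumOfEarlier b m
  lowered-sum-window {m} (j≤m , m<j+L)
    with R (suc m) (s≤s z≤n) (≤-trans m<j+L j+L≤N) | summands-admissible (s≤s j≤m) m<j+L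
  ... | r≤t , t<1+m , a-sum | adm-t , adm-r
    with halved-summand t<1+m m<j+L adm-t | halved-summand (≤-<-trans r≤t t<1+m) m<j+L adm-r
  ... | t′ , t′<m , a-t | r′ , r′<m , a-r = r′ , t′ , r′<m , t′<m , *-cancelˡ-≡ _ _ 2 (begin
    2 * b m                        ≡⟨ sym (lowered-double (m≤n⇒m≤1+n j≤m) m<j+L) ⟩
    a (suc m)                      ≡⟨ a-sum ⟩
    a (t (suc m)) + a (r (suc m))  ≡⟨ cong₂ _+_ a-t a-r ⟩
    2 * b t′ + 2 * b r′            ≡⟨ sym (*-distribˡ-+ 2 (b t′) (b r′)) ⟩
    2 * (b t′ + b r′)              ∎)
    where open ≡-Reasoning

  lowered-sum-end : ∀ {k} → 1 ≤ k → k ≡ j + L → SumOfEarlier b k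
  lowered-sum-end {suc k} _ 1+k≡j+L = k , k , ≤-refl , ≤-refl , (begin
    b (suc k)  ≡⟨ lowerBlock-above (≤-reflexive (sym 1+k≡j+L)) ⟩
    a (suc k)  ≡⟨ lowered-double j≤1+k k<j+L ⟩
    2 * b k    ≡⟨ cong (b k +_) (+-identityʳ (b k)) ⟩
    b k + b k  ∎)
    where
    open ≡-Reasoning
    j≤1+k = subst (j ≤_) (sym 1+k≡j+L) (m≤m+n j L)
    k<j+L = subst (k <_) 1+k≡j+L ≤-refl

  lowered-sum-outside : ∀ {k} → 1 ≤ k → k ≤ N → ¬ Window j L k →
    ¬ Window j L (t k) → ¬ Window j L (r k) → SumOfEarlier b k
  lowered-sum-outside {k} 1≤k k≤N k∉ t∉ r∉ with R k 1≤k k≤N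
  ... | r≤t , t<k , a-sum = r k , t k , ≤-<-trans r≤t t<k , t<k , (begin
    b k                ≡⟨ lowerBlock-outside k∉ ⟩
    a k                ≡⟨ a-sum ⟩
    a (t k) + a (r k)  ≡⟨ sym (cong₂ _+_ (lowerBlock-outside t∉) (lowerBlock-outside r∉)) ⟩
    b (t k) + b (r k)  ∎)
    where open ≡-Reasoning

  module _ (unread : ∀ u → u ≤ N → ¬ ReadsWindow t r j L u) where

    lowered-sums : ∀ k → 1 ≤ k → k ≤ N → SumOfEarlier b k
    lowered-sums k 1≤k k≤N with k <? j
    ... | yes k<j =
      let (r≤t , t<k , _) = R k 1≤k k≤N
      in lowered-sum-outside 1≤k k≤N (below k<j) (below (<-trans t<k k<j))
           (below (≤-<-trans r≤t (<-trans t<k k<j)))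
      where
      below : ∀ {x} → x < j → ¬ Window j L x
      below x<j (j≤x , _) = <⇒≱ x<j j≤x
    ... | no k≮j with <-cmp k (j + L)
    ...   | tri< k<j+L _ _ = lowered-sum-window (≮⇒≥ k≮j , k<j+L)
    ...   | tri≈ _ k≡j+L _ = lowered-sum-end 1≤k k≡j+L
    ...   | tri> _ _ j+L<k = lowered-sum-outside 1≤k k≤N
            (λ (_ , k<j+L) → <-asym k<j+L j+L<k)
            (λ w → unread k k≤N (j+L<k , inj₁ w))
            (λ w → unread k k≤N (j+L<k , inj₂ w))

    lowered-chain : IsAdditionChain N b (a N)
    lowered-chain = record
      { start      = trans (lowerBlock-below 1≤j) start
      ; increasing = lowered-increasing
      ; sums       = lowered-sums
      ; end        = lowerBlock-above j+L≤N
      }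

  lowered-dominated : 1 ≤ L → Dominates N a b
  lowered-dominated 1≤L =
    (λ i _ → lowered-≤ i) ,
    j , ≤-trans (m≤m+n j L) j+L≤N , lowered-<-window (≤-refl , m<m+n j 1≤L)

lemma14 : (N n : ℕ) (a t r : ℕ → ℕ) →
    IsAdditionChain N a n →
    IsRepresentation N a t r →
    (j L : ℕ) → 1 ≤ j → 1 ≤ L → j + L + 1 ≤ N →
    Doubling a j →
    Doubling a (j + L + 1) →
    (∀ s → j + 1 ≤ s → s ≤ j + L → ¬ Doubling a s) →
    (∀ s → j + 1 ≤ s → s ≤ j + L →
       (t s < j + 1 → Doubling a (t s)) × (r s < j + 1 → Doubling a (r s))) →
    Valid N a →
    ∃ λ s → ∃ λ u → j ≤ s × s < j + L × j + L < u × u ≤ N × (s ≡ t u ⊎ s ≡ r u)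
lemma14 N n a t r C R j L 1≤j 1≤L j+L+1≤N doubling-j _ nondoubling summands valid
  with anyUpTo? (readsWindow? t r j L) (suc N)
... | yes (u , s≤s u≤N , j+L<u , inj₁ (j≤t , t<j+L)) =
  t u , u , j≤t , t<j+L , j+L<u , u≤N , inj₁ refl
... | yes (u , s≤s u≤N , j+L<u , inj₂ (j≤r , r<j+L)) =
  r u , u , j≤r , r<j+L , j+L<u , u≤N , inj₂ refl
... | no unread =
  contradiction (b , lowered-chain (λ u u≤N reads → unread (u , s≤s u≤N , reads)) , lowered-dominated 1≤L) valid
  where
  open Lowering C R 1≤j (≤-trans (m≤m+n (j + L) 1) j+L+1≤N) doubling-j nondoubling summands
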